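{- Let $N\ge2$ and let $r=\log_2 N+4$ (assumed to be an integer). If $a_1,\dots,a_r,t$ are chosen independently and uniformly at random from $\{0,\dots,N-1\}$, then the probability that there is no $B\subseteq\{1,\dots,r\}$ with $\sum_{i\in B}a_i\equiv t\pmod N$ is at most $\frac12$. -}

module Defs where

open import Data.Nat using (ℕ; zero; suc; _+_; _*_; _%_; NonZero)
open import Data.Bool using (Bool; true; false; if_then_else_)
open import Data.Fin using (Fin; toℕ)
open import Data.Fin.Subset using (Subset)
open import Data.Vec using (Vec; []; _∷_; lookup)
open import Data.List using (List; map; allFin)
open import Data.Nat.ListAction using (sum)
open import Data.Nat.Properties using (_≟_)
open import Data.Fin.Subset.Properties using (anySubset?)
open import Relation.Nullary using (¬?)
open import Data.Product using (∃)
open import Relation.Binary.PropositionalEquality using (_≡_)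
open import Relation.Nullary using (¬_; Dec; does)

Σ[<_] : (n : ℕ) → (Fin n → ℕ) → ℕ
Σ[< n ] f = sum (map f (allFin n))

subsetSum : ∀ {N r} → Vec (Fin N) r → Subset r → ℕ
subsetSum {r = r} a B = Σ[< r ] (λ i → if lookup B i then toℕ (lookup a i) else 0)

NoSubsetSum : (N : ℕ) → .{{NonZero N}} → ∀ {r} → Vec (Fin N) r → Fin N → Set
NoSubsetSum N {r} a t = ¬ ∃ λ (B : Subset r) → subsetSum a B % N ≡ toℕ t % N

countVec : (N r : ℕ) → (P : Vec (Fin N) r → Set) → ((v : Vec (Fin N) r) → Dec (P v)) → ℕ
countVec N zero P P? = if does (P? []) then 1 else 0
countVec N (suc r) P P? = Σ[< N ] (λ x → countVec N r (λ v → P (x ∷ v)) (λ v → P? (x ∷ v)))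

noSubsetSum? : (N : ℕ) → .{{_ : NonZero N}} → ∀ {r} (a : Vec (Fin N) r) (t : Fin N) → Dec (NoSubsetSum N a t)
noSubsetSum? N a t = ¬? (anySubset? (λ B → subsetSum a B % N ≟ toℕ t % N))

badCount : (N r : ℕ) → .{{_ : NonZero N}} → ℕ
badCount N r = Σ[< N ] (λ t → countVec N r (λ a → NoSubsetSum N a t) (λ a → noSubsetSum? N a t))

{-# OPTIONS --safe #-}
module Submission where

-- The second moment method.  Let X(a, t) count the B with Σ_{i∈B} a_i ≡ t (mod N), so that
-- E X = 2^r / N.  For B ≠ B′ the congruences Σ_B a ≡ t and Σ_{B′} a ≡ t are independent: summing
-- over a coordinate in which B and B′ differ moves one side, but not the other, through every
-- residue.  Hence E X² ≤ E X + (E X)², and P(X = 0) ≤ Var X / (E X)² ≤ 1 / E X = N / 2^r, which is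
-- 1/16 for r = log₂ N + 4.

open import Defs
open import Data.Nat using (ℕ; zero; suc; _+_; _*_; _∸_; _^_; _%_; _≤_; _<_; NonZero; s≤s; z≤n)
open import Data.Nat.Properties
open import Data.Nat.DivMod using (%-distribˡ-+; m%n%n≡m%n; m%n<n; m<n⇒m%n≡m; [m+n]%n≡m%n)
open import Data.Nat.ListAction using (sum)
open import Data.Nat.ListAction.Properties using (sum-++)
open import Data.Nat.Tactic.RingSolver using (solve-∀)
open import Data.Bool using (Bool; true; false; if_then_else_)
import Data.Bool.Properties as Bool
open import Data.Fin using (Fin; zero; suc; toℕ)
open import Data.Fin.Properties using (toℕ<n)
open import Data.Fin.Subset using (Subset)
open import Data.Vec using (Vec; []; _∷_)
open import Data.Vec.Properties using (≡-dec)
open import Data.List using (List; []; _∷_; map; length; _++_; allFin; cartesianProductWith; cartesianProduct)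
open import Data.List.Properties
  using (map-cong; map-++; map-∘; length-++; length-map; map-tabulate; length-tabulate)
open import Data.Product using (_×_; _,_; uncurry)
open import Data.Sum using (inj₁; inj₂)
open import Data.Empty using (⊥-elim)
open import Function using (_∘_; id)
open import Relation.Binary.Definitions using (DecidableEquality)
open import Relation.Binary.PropositionalEquality
open import Relation.Nullary using (Dec; yes; no; does; ¬_; _×-dec_)
open import Relation.Nullary.Decidable using (dec-true; dec-false)
open import Relation.Unary using (Decidable)
open import Algebra.Properties.CommutativeSemigroup +-commutativeSemigroup
  using (interchange; xy∙z≈xz∙y; xy∙z≈x∙zy; x∙yz≈zy∙x; x∙yz≈yx∙z)

𝟙 : {P : Set} → Dec P → ℕ
𝟙 d = if does d then 1 else 0

𝟙-yes : {P : Set} (d : Dec P) → P → 𝟙 d ≡ 1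
𝟙-yes d p = cong (if_then 1 else 0) (dec-true d p)

𝟙-no : {P : Set} (d : Dec P) → ¬ P → 𝟙 d ≡ 0
𝟙-no d ¬p = cong (if_then 1 else 0) (dec-false d ¬p)

𝟙≤1 : {P : Set} (d : Dec P) → 𝟙 d ≤ 1
𝟙≤1 (yes _) = ≤-refl
𝟙≤1 (no _)  = z≤n

*𝟙-congˡ : {P : Set} {m n : ℕ} (d : Dec P) → (P → m ≡ n) → m * 𝟙 d ≡ n * 𝟙 d
*𝟙-congˡ (yes p) m≡n = cong (_* 1) (m≡n p)
*𝟙-congˡ {m = m} {n} (no _) m≡n = trans (*-zeroʳ m) (sym (*-zeroʳ n))

module _ {P Q : Set} where

  𝟙-⇔ : (d : Dec P) (e : Dec Q) → (P → Q) → (Q → P) → 𝟙 d ≡ 𝟙 e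
  𝟙-⇔ (yes p) e to from = sym (𝟙-yes e (to p))
  𝟙-⇔ (no ¬p) e to from = sym (𝟙-no e (¬p ∘ from))

  𝟙-× : (d : Dec P) (e : Dec Q) → 𝟙 (d ×-dec e) ≡ 𝟙 d * 𝟙 e
  𝟙-× (yes _) e = sym (+-identityʳ (𝟙 e))
  𝟙-× (no _)  e = refl

-- Σ[< n ] f from Defs is ∑⟨ allFin n ⟩ f by definition.
∑⟨_⟩ : {A : Set} → List A → (A → ℕ) → ℕ
∑⟨ xs ⟩ f = sum (map f xs)

module _ {A : Set} where

  ∑-cong : (xs : List A) {f g : A → ℕ} → f ≗ g → ∑⟨ xs ⟩ f ≡ ∑⟨ xs ⟩ g
  ∑-cong xs f≗g = cong sum (map-cong f≗g xs)

  ∑-distrib-+ : (xs : List A) (f g : A → ℕ) →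
                ∑⟨ xs ⟩ (λ x → f x + g x) ≡ ∑⟨ xs ⟩ f + ∑⟨ xs ⟩ g
  ∑-distrib-+ []       f g = refl
  ∑-distrib-+ (x ∷ xs) f g =
    trans (cong (f x + g x +_) (∑-distrib-+ xs f g)) (interchange (f x) (g x) _ _)

  *-distribˡ-∑ : (k : ℕ) (xs : List A) (f : A → ℕ) →
                 k * ∑⟨ xs ⟩ f ≡ ∑⟨ xs ⟩ (λ x → k * f x)
  *-distribˡ-∑ k []       f = *-zeroʳ k
  *-distribˡ-∑ k (x ∷ xs) f = trans (*-distribˡ-+ k (f x) _) (cong (k * f x +_) (*-distribˡ-∑ k xs f))

  ∑-const : (xs : List A) (k : ℕ) → ∑⟨ xs ⟩ (λ _ → k) ≡ k * length xs
  ∑-const []       k = sym (*-zeroʳ k)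
  ∑-const (x ∷ xs) k = trans (cong (k +_) (∑-const xs k)) (sym (*-suc k (length xs)))

  ∑-mono-≤ : (xs : List A) {f g : A → ℕ} → (∀ x → f x ≤ g x) → ∑⟨ xs ⟩ f ≤ ∑⟨ xs ⟩ g
  ∑-mono-≤ []       f≤g = z≤n
  ∑-mono-≤ (x ∷ xs) f≤g = +-mono-≤ (f≤g x) (∑-mono-≤ xs f≤g)

  ∑-map : {B : Set} (h : B → A) (ys : List B) (f : A → ℕ) →
          ∑⟨ map h ys ⟩ f ≡ ∑⟨ ys ⟩ (f ∘ h)
  ∑-map h ys f = cong sum (sym (map-∘ ys))

  ∑-++ : (xs ys : List A) (f : A → ℕ) → ∑⟨ xs ++ ys ⟩ f ≡ ∑⟨ xs ⟩ f + ∑⟨ ys ⟩ f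
  ∑-++ xs ys f = trans (cong sum (map-++ f xs ys)) (sum-++ (map f xs) (map f ys))

module _ {A B : Set} where

  ∑-comm : (xs : List A) (ys : List B) (f : A → B → ℕ) →
           ∑⟨ xs ⟩ (λ x → ∑⟨ ys ⟩ (f x)) ≡ ∑⟨ ys ⟩ (λ y → ∑⟨ xs ⟩ (λ x → f x y))
  ∑-comm []       ys f = sym (∑-const ys 0)
  ∑-comm (x ∷ xs) ys f = trans (cong (∑⟨ ys ⟩ (f x) +_) (∑-comm xs ys f))
                               (sym (∑-distrib-+ ys (f x) (λ y → ∑⟨ xs ⟩ (λ x → f x y))))

  ∑-*-∑ : (xs : List A) (ys : List B) (f : A → ℕ) (g : B → ℕ) →
          ∑⟨ xs ⟩ f * ∑⟨ ys ⟩ g ≡ ∑⟨ xs ⟩ (λ x → ∑⟨ ys ⟩ (λ y → f x * g y))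
  ∑-*-∑ xs ys f g = begin
    ∑⟨ xs ⟩ f * ∑⟨ ys ⟩ g               ≡⟨ *-comm (∑⟨ xs ⟩ f) _ ⟩
    ∑⟨ ys ⟩ g * ∑⟨ xs ⟩ f               ≡⟨ *-distribˡ-∑ (∑⟨ ys ⟩ g) xs f ⟩
    ∑⟨ xs ⟩ (λ x → ∑⟨ ys ⟩ g * f x)     ≡⟨ ∑-cong xs (λ x → *-comm (∑⟨ ys ⟩ g) (f x)) ⟩
    ∑⟨ xs ⟩ (λ x → f x * ∑⟨ ys ⟩ g)     ≡⟨ ∑-cong xs (λ x → *-distribˡ-∑ (f x) ys g) ⟩
    ∑⟨ xs ⟩ (λ x → ∑⟨ ys ⟩ (λ y → f x * g y)) ∎
    where open ≡-Reasoning

  module _ {C : Set} (h : A → B → C) where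

    ∑-cartesianProductWith : (xs : List A) (ys : List B) (f : C → ℕ) →
      ∑⟨ cartesianProductWith h xs ys ⟩ f ≡ ∑⟨ xs ⟩ (λ x → ∑⟨ ys ⟩ (λ y → f (h x y)))
    ∑-cartesianProductWith []       ys f = refl
    ∑-cartesianProductWith (x ∷ xs) ys f = begin
      ∑⟨ map (h x) ys ++ cartesianProductWith h xs ys ⟩ f    ≡⟨ ∑-++ (map (h x) ys) _ f ⟩
      ∑⟨ map (h x) ys ⟩ f + ∑⟨ cartesianProductWith h xs ys ⟩ f
        ≡⟨ cong₂ _+_ (∑-map (h x) ys f) (∑-cartesianProductWith xs ys f) ⟩
      ∑⟨ ys ⟩ (f ∘ h x) + ∑⟨ xs ⟩ (λ x → ∑⟨ ys ⟩ (λ y → f (h x y))) ∎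
      where open ≡-Reasoning

    length-cartesianProductWith : (xs : List A) (ys : List B) →
      length (cartesianProductWith h xs ys) ≡ length xs * length ys
    length-cartesianProductWith []       ys = refl
    length-cartesianProductWith (x ∷ xs) ys =
      trans (length-++ (map (h x) ys)) (cong₂ _+_ (length-map (h x) ys) (length-cartesianProductWith xs ys))

module _ {A : Set} where

  allVecs : List A → (r : ℕ) → List (Vec A r)
  allVecs xs zero    = [] ∷ []
  allVecs xs (suc r) = cartesianProductWith _∷_ xs (allVecs xs r)

  length-allVecs : (xs : List A) (r : ℕ) → length (allVecs xs r) ≡ length xs ^ r
  length-allVecs xs zero    = refl
  length-allVecs xs (suc r) =
    trans (length-cartesianProductWith _∷_ xs (allVecs xs r)) (cong (length xs *_) (length-allVecs xs r))

  ∑-allVecs-suc : (xs : List A) (r : ℕ) (f : Vec A (suc r) → ℕ) →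
    ∑⟨ allVecs xs (suc r) ⟩ f ≡ ∑⟨ xs ⟩ (λ x → ∑⟨ allVecs xs r ⟩ (λ v → f (x ∷ v)))
  ∑-allVecs-suc xs r f = ∑-cartesianProductWith _∷_ xs (allVecs xs r) f

  ∑-𝟙≡-allVecs : (_≟_ : DecidableEquality A) (xs : List A) →
    (∀ x → ∑⟨ xs ⟩ (λ y → 𝟙 (x ≟ y)) ≡ 1) →
    ∀ {r} (v : Vec A r) → ∑⟨ allVecs xs r ⟩ (λ w → 𝟙 (≡-dec _≟_ v w)) ≡ 1
  ∑-𝟙≡-allVecs _≟_ xs unique []      = refl
  ∑-𝟙≡-allVecs _≟_ xs unique {suc r} (x ∷ v) = begin
    ∑⟨ allVecs xs (suc r) ⟩ (λ w → 𝟙 (≡-dec _≟_ (x ∷ v) w))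
      ≡⟨ ∑-allVecs-suc xs r _ ⟩
    ∑⟨ xs ⟩ (λ y → ∑⟨ allVecs xs r ⟩ (λ w → 𝟙 ((x ≟ y) ×-dec ≡-dec _≟_ v w)))
      ≡⟨ ∑-cong xs (λ y → ∑-cong (allVecs xs r) (λ w → 𝟙-× (x ≟ y) (≡-dec _≟_ v w))) ⟩
    ∑⟨ xs ⟩ (λ y → ∑⟨ allVecs xs r ⟩ (λ w → 𝟙 (x ≟ y) * 𝟙 (≡-dec _≟_ v w)))
      ≡⟨ ∑-cong xs (λ y → sym (*-distribˡ-∑ (𝟙 (x ≟ y)) (allVecs xs r) _)) ⟩
    ∑⟨ xs ⟩ (λ y → 𝟙 (x ≟ y) * ∑⟨ allVecs xs r ⟩ (λ w → 𝟙 (≡-dec _≟_ v w)))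
      ≡⟨ ∑-cong xs (λ y → cong (𝟙 (x ≟ y) *_) (∑-𝟙≡-allVecs _≟_ xs unique v)) ⟩
    ∑⟨ xs ⟩ (λ y → 𝟙 (x ≟ y) * 1)
      ≡⟨ ∑-cong xs (λ y → *-identityʳ (𝟙 (x ≟ y))) ⟩
    ∑⟨ xs ⟩ (λ y → 𝟙 (x ≟ y))
      ≡⟨ unique x ⟩
    1 ∎
    where open ≡-Reasoning

countVec≡∑ : (N r : ℕ) (P : Vec (Fin N) r → Set) (P? : ∀ v → Dec (P v)) →
  countVec N r P P? ≡ ∑⟨ allVecs (allFin N) r ⟩ (𝟙 ∘ P?)
countVec≡∑ N zero    P P? = sym (+-identityʳ (𝟙 (P? [])))
countVec≡∑ N (suc r) P P? = trans (∑-cong (allFin N) (λ x → countVec≡∑ N r _ _))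
                                  (sym (∑-allVecs-suc (allFin N) r (𝟙 ∘ P?)))

allSubsets : (r : ℕ) → List (Subset r)
allSubsets = allVecs (false ∷ true ∷ [])

length-allSubsets : (r : ℕ) → length (allSubsets r) ≡ 2 ^ r
length-allSubsets = length-allVecs (false ∷ true ∷ [])

_≟ˢ_ : ∀ {r} → DecidableEquality (Subset r)
_≟ˢ_ = ≡-dec Bool._≟_

∑-𝟙≡-allSubsets : ∀ {r} (B : Subset r) → ∑⟨ allSubsets r ⟩ (λ B′ → 𝟙 (B ≟ˢ B′)) ≡ 1
∑-𝟙≡-allSubsets = ∑-𝟙≡-allVecs Bool._≟_ (false ∷ true ∷ []) λ { false → refl ; true → refl }

Σ[<]-suc : (n : ℕ) (f : Fin (suc n) → ℕ) → Σ[< suc n ] f ≡ f zero + Σ[< n ] (f ∘ suc)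
Σ[<]-suc n f = cong (λ xs → f zero + sum xs)
  (trans (map-tabulate suc f) (sym (map-tabulate id (f ∘ suc))))

length-allFin : (n : ℕ) → length (allFin n) ≡ n
length-allFin n = length-tabulate id

-- 𝟙 (0 ≟ suc i) computes to 0 and 𝟙 (suc j ≟ suc i) to 𝟙 (j ≟ i).
∑-𝟙≡-allFin : ∀ {n j} → j < n → Σ[< n ] (λ t → 𝟙 (j ≟ toℕ t)) ≡ 1
∑-𝟙≡-allFin {suc n} {zero}  _         =
  trans (Σ[<]-suc n (λ t → 𝟙 (0 ≟ toℕ t))) (cong suc (∑-const (allFin n) 0))
∑-𝟙≡-allFin {suc n} {suc j} (s≤s j<n) =
  trans (Σ[<]-suc n (λ t → 𝟙 (suc j ≟ toℕ t))) (∑-𝟙≡-allFin j<n)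

m≤n⇒2mn≤m²+n² : ∀ {m n} → m ≤ n → 2 * m * n ≤ m * m + n * n
m≤n⇒2mn≤m²+n² {m} m≤n with d , refl ← m≤n⇒∃[o]m+o≡n m≤n =
  subst (2 * m * (m + d) ≤_) (sym (expand m d)) (m≤m+n _ (d * d))
  where
  expand : ∀ m d → m * m + (m + d) * (m + d) ≡ 2 * m * (m + d) + d * d
  expand = solve-∀

2mn≤m²+n² : ∀ m n → 2 * m * n ≤ m * m + n * n
2mn≤m²+n² m n with ≤-total m n
... | inj₁ m≤n = m≤n⇒2mn≤m²+n² m≤n
... | inj₂ n≤m = subst₂ _≤_ (2nm≡2mn n m) (+-comm (n * n) (m * m)) (m≤n⇒2mn≤m²+n² n≤m)
  where
  2nm≡2mn : ∀ n m → 2 * n * m ≡ 2 * m * n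
  2nm≡2mn = solve-∀

-- Summing c² [X = 0] ≤ (n X − c)² over xs, with the square expanded so that no subtraction occurs.
module _ {A : Set} {P : A → Set} (P? : Decidable P) (X : A → ℕ)
         (P⇒X≡0 : ∀ x → P x → X x ≡ 0) (c n : ℕ) where

  second-moment-pointwise : ∀ x → c * c * 𝟙 (P? x) + 2 * c * n * X x ≤ n * n * (X x * X x) + c * c
  second-moment-pointwise x with P? x
  ... | yes p rewrite P⇒X≡0 x p = ≤-reflexive (at-zero c n)
    where
    at-zero : ∀ c n → c * c * 1 + 2 * c * n * 0 ≡ n * n * (0 * 0) + c * c
    at-zero = solve-∀
  ... | no _ = subst₂ _≤_ (lhs c n (X x)) (rhs c n (X x)) (2mn≤m²+n² (n * X x) c)
    where
    lhs : ∀ c n x → 2 * (n * x) * c ≡ c * c * 0 + 2 * c * n * x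
    lhs = solve-∀
    rhs : ∀ c n x → n * x * (n * x) + c * c ≡ n * n * (x * x) + c * c
    rhs = solve-∀

  second-moment-method : (xs : List A) →
    c * c * ∑⟨ xs ⟩ (𝟙 ∘ P?) + 2 * c * n * ∑⟨ xs ⟩ X ≤
    n * n * ∑⟨ xs ⟩ (λ x → X x * X x) + c * c * length xs
  second-moment-method xs = begin
    c * c * ∑⟨ xs ⟩ (𝟙 ∘ P?) + 2 * c * n * ∑⟨ xs ⟩ X
      ≡⟨ cong₂ _+_ (*-distribˡ-∑ (c * c) xs _) (*-distribˡ-∑ (2 * c * n) xs X) ⟩
    ∑⟨ xs ⟩ (λ x → c * c * 𝟙 (P? x)) + ∑⟨ xs ⟩ (λ x → 2 * c * n * X x)
      ≡⟨ ∑-distrib-+ xs _ _ ⟨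
    ∑⟨ xs ⟩ (λ x → c * c * 𝟙 (P? x) + 2 * c * n * X x)
      ≤⟨ ∑-mono-≤ xs second-moment-pointwise ⟩
    ∑⟨ xs ⟩ (λ x → n * n * (X x * X x) + c * c)
      ≡⟨ ∑-distrib-+ xs _ _ ⟩
    ∑⟨ xs ⟩ (λ x → n * n * (X x * X x)) + ∑⟨ xs ⟩ (λ _ → c * c)
      ≡⟨ cong₂ _+_ (*-distribˡ-∑ (n * n) xs _) (sym (∑-const xs (c * c))) ⟨
    n * n * ∑⟨ xs ⟩ (λ x → X x * X x) + c * c * length xs ∎
    where open ≤-Reasoning

subsetSum-∷ : ∀ {N r} (x : Fin N) (a : Vec (Fin N) r) (b : Bool) (B : Subset r) →
  subsetSum (x ∷ a) (b ∷ B) ≡ (if b then toℕ x else 0) + subsetSum a B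
subsetSum-∷ {r = r} x a b B = Σ[<]-suc r _

module _ (N : ℕ) .{{_ : NonZero N}} where

  δ : ℕ → ℕ → ℕ
  δ p q = 𝟙 (p % N ≟ q % N)

  δ≤1 : ∀ p q → δ p q ≤ 1
  δ≤1 p q = 𝟙≤1 (p % N ≟ q % N)

  δ-sym : ∀ p q → δ p q ≡ δ q p
  δ-sym p q = 𝟙-⇔ (p % N ≟ q % N) (q % N ≟ p % N) sym sym

  [m+n%N]%N≡[m+n]%N : ∀ m n → (m + n % N) % N ≡ (m + n) % N
  [m+n%N]%N≡[m+n]%N m n = begin
    (m + n % N) % N            ≡⟨ %-distribˡ-+ m (n % N) N ⟩
    (m % N + n % N % N) % N    ≡⟨ cong (λ k → (m % N + k) % N) (m%n%n≡m%n n N) ⟩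
    (m % N + n % N) % N        ≡⟨ %-distribˡ-+ m n N ⟨
    (m + n) % N                ∎
    where open ≡-Reasoning

  [m+n+[N∸n%N]]%N≡m%N : ∀ m n → (m + n + (N ∸ n % N)) % N ≡ m % N
  [m+n+[N∸n%N]]%N≡m%N m n = begin
    (m + n + (N ∸ n % N)) % N         ≡⟨ cong (_% N) (xy∙z≈xz∙y m n _) ⟩
    (m + (N ∸ n % N) + n) % N         ≡⟨ [m+n%N]%N≡[m+n]%N _ n ⟨
    (m + (N ∸ n % N) + n % N) % N     ≡⟨ cong (_% N) (xy∙z≈x∙zy m _ (n % N)) ⟩
    (m + (n % N + (N ∸ n % N))) % N   ≡⟨ cong (λ k → (m + k) % N) (m+[n∸m]≡n (<⇒≤ (m%n<n n N))) ⟩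
    (m + N) % N                       ≡⟨ [m+n]%n≡m%n m N ⟩
    m % N                             ∎
    where open ≡-Reasoning

  ∑-δ-allFin : ∀ m → Σ[< N ] (λ t → δ m (toℕ t)) ≡ 1
  ∑-δ-allFin m = trans
    (∑-cong (allFin N) (λ t → cong (λ k → 𝟙 (m % N ≟ k)) (m<n⇒m%n≡m (toℕ<n t))))
    (∑-𝟙≡-allFin (m%n<n m N))

  -- x ↦ m + x is a bijection modulo N, with inverse z ↦ z + (N ∸ m % N).
  ∑-δ-shift : ∀ m z → Σ[< N ] (λ x → δ (m + toℕ x) z) ≡ 1
  ∑-δ-shift m z = trans (∑-cong (allFin N) (λ x → 𝟙-⇔ (_ ≟ _) (_ ≟ toℕ x) (to x) (from x)))
                        (∑-𝟙≡-allFin (m%n<n (z + (N ∸ m % N)) N))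
    where
    open ≡-Reasoning
    to : ∀ x → (m + toℕ x) % N ≡ z % N → (z + (N ∸ m % N)) % N ≡ toℕ x
    to x eq = begin
      (z + (N ∸ m % N)) % N             ≡⟨ cong (_% N) (+-comm z _) ⟩
      ((N ∸ m % N) + z) % N             ≡⟨ [m+n%N]%N≡[m+n]%N _ z ⟨
      ((N ∸ m % N) + z % N) % N         ≡⟨ cong (λ k → ((N ∸ m % N) + k) % N) eq ⟨
      ((N ∸ m % N) + (m + toℕ x) % N) % N ≡⟨ [m+n%N]%N≡[m+n]%N _ (m + toℕ x) ⟩
      ((N ∸ m % N) + (m + toℕ x)) % N   ≡⟨ cong (_% N) (x∙yz≈zy∙x _ m (toℕ x)) ⟩
      (toℕ x + m + (N ∸ m % N)) % N     ≡⟨ [m+n+[N∸n%N]]%N≡m%N (toℕ x) m ⟩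
      toℕ x % N                         ≡⟨ m<n⇒m%n≡m (toℕ<n x) ⟩
      toℕ x                             ∎
    from : ∀ x → (z + (N ∸ m % N)) % N ≡ toℕ x → (m + toℕ x) % N ≡ z % N
    from x eq = begin
      (m + toℕ x) % N                   ≡⟨ cong (λ k → (m + k) % N) eq ⟨
      (m + (z + (N ∸ m % N)) % N) % N   ≡⟨ [m+n%N]%N≡[m+n]%N m _ ⟩
      (m + (z + (N ∸ m % N))) % N       ≡⟨ cong (_% N) (x∙yz≈yx∙z m z _) ⟩
      (z + m + (N ∸ m % N)) % N         ≡⟨ [m+n+[N∸n%N]]%N≡m%N z m ⟩
      z % N                             ∎

  vectors : (r : ℕ) → List (Vec (Fin N) r)
  vectors = allVecs (allFin N)

  length-vectors : ∀ r → length (vectors r) ≡ N ^ r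
  length-vectors r = trans (length-allVecs (allFin N) r) (cong (_^ r) (length-allFin N))

  ∑-const-vectors : ∀ r k → ∑⟨ vectors r ⟩ (λ _ → k) ≡ k * N ^ r
  ∑-const-vectors r k = trans (∑-const (vectors r) k) (cong (k *_) (length-vectors r))

  -- The offsets u and v record the contributions of coordinates already summed over.
  agreements : ∀ {r} → Subset r → Subset r → ℕ → ℕ → ℕ
  agreements {r} B B′ u v = ∑⟨ vectors r ⟩ (λ a → δ (u + subsetSum a B) (v + subsetSum a B′))

  agreements-sym : ∀ {r} (B B′ : Subset r) u v → agreements B B′ u v ≡ agreements B′ B v u
  agreements-sym {r} B B′ u v =
    ∑-cong (vectors r) (λ a → δ-sym (u + subsetSum a B) (v + subsetSum a B′))

  agreements≤N^r : ∀ {r} (B B′ : Subset r) u v → agreements B B′ u v ≤ N ^ r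
  agreements≤N^r {r} B B′ u v = begin
    agreements B B′ u v
      ≤⟨ ∑-mono-≤ (vectors r) (λ a → δ≤1 (u + subsetSum a B) (v + subsetSum a B′)) ⟩
    ∑⟨ vectors r ⟩ (λ _ → 1)  ≡⟨ ∑-const-vectors r 1 ⟩
    1 * N ^ r                 ≡⟨ *-identityˡ (N ^ r) ⟩
    N ^ r                     ∎
    where open ≤-Reasoning

  agreements-∷ : ∀ {r} b b′ (B B′ : Subset r) u v →
    agreements (b ∷ B) (b′ ∷ B′) u v ≡
    Σ[< N ] (λ x → agreements B B′ (u + (if b then toℕ x else 0)) (v + (if b′ then toℕ x else 0)))
  agreements-∷ {r} b b′ B B′ u v = trans (∑-allVecs-suc (allFin N) r _)
    (∑-cong (allFin N) λ x → ∑-cong (vectors r) λ a →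
      cong₂ δ (reassociate u x a b B) (reassociate v x a b′ B′))
    where
    reassociate : ∀ w x a b B →
                  w + subsetSum (x ∷ a) (b ∷ B) ≡ w + (if b then toℕ x else 0) + subsetSum a B
    reassociate w x a b B = trans (cong (w +_) (subsetSum-∷ x a b B)) (sym (+-assoc w _ _))

  agreements-true∷-false∷ : ∀ {r} (B B′ : Subset r) u v →
                            agreements (true ∷ B) (false ∷ B′) u v ≡ N ^ r
  agreements-true∷-false∷ {r} B B′ u v = begin
    agreements (true ∷ B) (false ∷ B′) u v
      ≡⟨ agreements-∷ true false B B′ u v ⟩
    Σ[< N ] (λ x → ∑⟨ vectors r ⟩ (λ a → δ (u + toℕ x + subsetSum a B) (v + 0 + subsetSum a B′)))
      ≡⟨ ∑-comm (allFin N) (vectors r) _ ⟩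
    ∑⟨ vectors r ⟩ (λ a → Σ[< N ] (λ x → δ (u + toℕ x + subsetSum a B) (v + 0 + subsetSum a B′)))
      ≡⟨ ∑-cong (vectors r) (λ a → ∑-cong (allFin N) (λ x →
           cong₂ δ (xy∙z≈xz∙y u (toℕ x) (subsetSum a B)) (cong (_+ subsetSum a B′) (+-identityʳ v)))) ⟩
    ∑⟨ vectors r ⟩ (λ a → Σ[< N ] (λ x → δ (u + subsetSum a B + toℕ x) (v + subsetSum a B′)))
      ≡⟨ ∑-cong (vectors r) (λ a → ∑-δ-shift (u + subsetSum a B) (v + subsetSum a B′)) ⟩
    ∑⟨ vectors r ⟩ (λ _ → 1)
      ≡⟨ ∑-const-vectors r 1 ⟩
    1 * N ^ r
      ≡⟨ *-identityˡ (N ^ r) ⟩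
    N ^ r ∎
    where open ≡-Reasoning

  agreements-distinct : ∀ {r} (B B′ : Subset r) u v → B ≢ B′ → N * agreements B B′ u v ≡ N ^ r
  agreements-distinct []      []        u v B≢B′ = ⊥-elim (B≢B′ refl)
  agreements-distinct {suc r} (b ∷ B) (b′ ∷ B′) u v B≢B′ with b Bool.≟ b′
  ... | yes refl = begin
    N * agreements (b ∷ B) (b ∷ B′) u v   ≡⟨ cong (N *_) (agreements-∷ b b B B′ u v) ⟩
    N * Σ[< N ] (λ x → agreements B B′ (u + w x) (v + w x))
      ≡⟨ *-distribˡ-∑ N (allFin N) _ ⟩
    Σ[< N ] (λ x → N * agreements B B′ (u + w x) (v + w x))
      ≡⟨ ∑-cong (allFin N) (λ x → agreements-distinct B B′ _ _ (B≢B′ ∘ cong (b ∷_))) ⟩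
    Σ[< N ] (λ _ → N ^ r)                 ≡⟨ ∑-const (allFin N) (N ^ r) ⟩
    N ^ r * length (allFin N)             ≡⟨ cong (N ^ r *_) (length-allFin N) ⟩
    N ^ r * N                             ≡⟨ *-comm (N ^ r) N ⟩
    N ^ suc r                             ∎
    where
    open ≡-Reasoning
    w : Fin N → ℕ
    w x = if b then toℕ x else 0
  ... | no b≢b′ = cong (N *_) (distinct-heads b b′ b≢b′)
    where
    distinct-heads : ∀ b b′ → b ≢ b′ → agreements (b ∷ B) (b′ ∷ B′) u v ≡ N ^ r
    distinct-heads false false f≢f = ⊥-elim (f≢f refl)
    distinct-heads true  true  t≢t = ⊥-elim (t≢t refl)
    distinct-heads true  false _   = agreements-true∷-false∷ B B′ u v
    distinct-heads false true  _   =
      trans (agreements-sym (false ∷ B) (true ∷ B′) u v) (agreements-true∷-false∷ B′ B v u)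

  N*agreements≤ : ∀ {r} (B B′ : Subset r) u v →
    N * agreements B B′ u v ≤ N ^ r + N ^ suc r * 𝟙 (B ≟ˢ B′)
  N*agreements≤ {r} B B′ u v with B ≟ˢ B′
  ... | yes refl = begin
    N * agreements B B u v  ≤⟨ *-monoʳ-≤ N (agreements≤N^r B B u v) ⟩
    N ^ suc r               ≡⟨ *-identityʳ (N ^ suc r) ⟨
    N ^ suc r * 1           ≤⟨ m≤n+m _ (N ^ r) ⟩
    N ^ r + N ^ suc r * 1   ∎
    where open ≤-Reasoning
  ... | no B≢B′  = ≤-trans (≤-reflexive (agreements-distinct B B′ u v B≢B′)) (m≤m+n (N ^ r) _)

  ∑-δδ≡δ : ∀ p q → Σ[< N ] (λ t → δ p (toℕ t) * δ q (toℕ t)) ≡ δ p q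
  ∑-δδ≡δ p q = begin
    Σ[< N ] (λ t → δ p (toℕ t) * δ q (toℕ t))
      ≡⟨ ∑-cong (allFin N) (λ t → δ-transfer (toℕ t)) ⟩
    Σ[< N ] (λ t → δ p q * δ q (toℕ t))  ≡⟨ *-distribˡ-∑ (δ p q) (allFin N) _ ⟨
    δ p q * Σ[< N ] (λ t → δ q (toℕ t))  ≡⟨ cong (δ p q *_) (∑-δ-allFin q) ⟩
    δ p q * 1                            ≡⟨ *-identityʳ (δ p q) ⟩
    δ p q                                ∎
    where
    open ≡-Reasoning
    δ-transfer : ∀ y → δ p y * δ q y ≡ δ p q * δ q y
    δ-transfer y = *𝟙-congˡ (q % N ≟ y % N) (λ q≡y → cong (λ k → 𝟙 (p % N ≟ k)) (sym q≡y))

  module _ (r : ℕ) where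

    outcomes : List (Vec (Fin N) r × Fin N)
    outcomes = cartesianProduct (vectors r) (allFin N)

    solutions : Vec (Fin N) r → Fin N → ℕ
    solutions a t = ∑⟨ allSubsets r ⟩ (λ B → δ (subsetSum a B) (toℕ t))

    length-outcomes : length outcomes ≡ N ^ r * N
    length-outcomes = trans (length-cartesianProductWith _,_ (vectors r) (allFin N))
      (cong₂ _*_ (length-vectors r) (length-allFin N))

    badCount≡∑ : badCount N r ≡ ∑⟨ outcomes ⟩ (uncurry λ a t → 𝟙 (noSubsetSum? N a t))
    badCount≡∑ = begin
      badCount N r
        ≡⟨ ∑-cong (allFin N) (λ t → countVec≡∑ N r _ _) ⟩
      Σ[< N ] (λ t → ∑⟨ vectors r ⟩ (λ a → 𝟙 (noSubsetSum? N a t)))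
        ≡⟨ ∑-comm (allFin N) (vectors r) _ ⟩
      ∑⟨ vectors r ⟩ (λ a → Σ[< N ] (λ t → 𝟙 (noSubsetSum? N a t)))
        ≡⟨ ∑-cartesianProductWith _,_ (vectors r) (allFin N) _ ⟨
      ∑⟨ outcomes ⟩ (uncurry λ a t → 𝟙 (noSubsetSum? N a t)) ∎
      where open ≡-Reasoning

    noSubsetSum⇒solutions≡0 : ∀ a t → NoSubsetSum N a t → solutions a t ≡ 0
    noSubsetSum⇒solutions≡0 a t none = trans
      (∑-cong (allSubsets r) (λ B → 𝟙-no (subsetSum a B % N ≟ toℕ t % N) (λ eq → none (B , eq))))
      (∑-const (allSubsets r) 0)

    ∑-solutions : ∑⟨ outcomes ⟩ (uncurry solutions) ≡ 2 ^ r * N ^ r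
    ∑-solutions = begin
      ∑⟨ outcomes ⟩ (uncurry solutions)
        ≡⟨ ∑-cartesianProductWith _,_ (vectors r) (allFin N) _ ⟩
      ∑⟨ vectors r ⟩ (λ a → Σ[< N ] (solutions a))
        ≡⟨ ∑-cong (vectors r) (λ a → ∑-comm (allFin N) (allSubsets r) _) ⟩
      ∑⟨ vectors r ⟩ (λ a → ∑⟨ allSubsets r ⟩ (λ B → Σ[< N ] (λ t → δ (subsetSum a B) (toℕ t))))
        ≡⟨ ∑-cong (vectors r) (λ a → ∑-cong (allSubsets r) (λ B → ∑-δ-allFin (subsetSum a B))) ⟩
      ∑⟨ vectors r ⟩ (λ a → ∑⟨ allSubsets r ⟩ (λ _ → 1))
        ≡⟨ ∑-cong (vectors r) (λ a → trans (∑-const (allSubsets r) 1) (*-identityˡ _)) ⟩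
      ∑⟨ vectors r ⟩ (λ _ → length (allSubsets r))
        ≡⟨ ∑-const-vectors r _ ⟩
      length (allSubsets r) * N ^ r
        ≡⟨ cong (_* N ^ r) (length-allSubsets r) ⟩
      2 ^ r * N ^ r ∎
      where open ≡-Reasoning

    collisions : Vec (Fin N) r → ℕ
    collisions a =
      ∑⟨ allSubsets r ⟩ (λ B → ∑⟨ allSubsets r ⟩ (λ B′ → δ (subsetSum a B) (subsetSum a B′)))

    Σ-solutions² : ∀ a → Σ[< N ] (λ t → solutions a t * solutions a t) ≡ collisions a
    Σ-solutions² a = begin
      Σ[< N ] (λ t → solutions a t * solutions a t)
        ≡⟨ ∑-cong (allFin N) (λ t → ∑-*-∑ (allSubsets r) (allSubsets r) (σ t) (σ t)) ⟩
      Σ[< N ] (λ t → ∑⟨ allSubsets r ⟩ (λ B → ∑⟨ allSubsets r ⟩ (λ B′ → σ t B * σ t B′)))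
        ≡⟨ ∑-comm (allFin N) (allSubsets r) _ ⟩
      ∑⟨ allSubsets r ⟩ (λ B → Σ[< N ] (λ t → ∑⟨ allSubsets r ⟩ (λ B′ → σ t B * σ t B′)))
        ≡⟨ ∑-cong (allSubsets r) (λ B → ∑-comm (allFin N) (allSubsets r) _) ⟩
      ∑⟨ allSubsets r ⟩ (λ B → ∑⟨ allSubsets r ⟩ (λ B′ → Σ[< N ] (λ t → σ t B * σ t B′)))
        ≡⟨ ∑-cong (allSubsets r) (λ B → ∑-cong (allSubsets r) (λ B′ →
             ∑-δδ≡δ (subsetSum a B) (subsetSum a B′))) ⟩
      collisions a ∎
      where
      open ≡-Reasoning
      σ : Fin N → Subset r → ℕ
      σ t B = δ (subsetSum a B) (toℕ t)

    ∑-solutions² : N * ∑⟨ outcomes ⟩ (uncurry λ a t → solutions a t * solutions a t) ≤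
                   (2 ^ r * N ^ r + N ^ suc r) * 2 ^ r
    ∑-solutions² = begin
      N * ∑⟨ outcomes ⟩ (uncurry λ a t → solutions a t * solutions a t)
        ≡⟨ cong (N *_) (∑-cartesianProductWith _,_ (vectors r) (allFin N) _) ⟩
      N * ∑⟨ vectors r ⟩ (λ a → Σ[< N ] (λ t → solutions a t * solutions a t))
        ≡⟨ cong (N *_) (∑-cong (vectors r) Σ-solutions²) ⟩
      N * ∑⟨ vectors r ⟩ collisions
        ≡⟨ cong (N *_) (trans (∑-comm (vectors r) (allSubsets r) _)
                              (∑-cong (allSubsets r) (λ B → ∑-comm (vectors r) (allSubsets r) _))) ⟩
      N * ∑⟨ allSubsets r ⟩ (λ B → ∑⟨ allSubsets r ⟩ (λ B′ → agreements B B′ 0 0))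
        ≡⟨ trans (*-distribˡ-∑ N (allSubsets r) _)
                 (∑-cong (allSubsets r) (λ B → *-distribˡ-∑ N (allSubsets r) _)) ⟩
      ∑⟨ allSubsets r ⟩ (λ B → ∑⟨ allSubsets r ⟩ (λ B′ → N * agreements B B′ 0 0))
        ≤⟨ ∑-mono-≤ (allSubsets r) (λ B →
             ∑-mono-≤ (allSubsets r) (λ B′ → N*agreements≤ B B′ 0 0)) ⟩
      ∑⟨ allSubsets r ⟩ (λ B → ∑⟨ allSubsets r ⟩ (λ B′ → N ^ r + N ^ suc r * 𝟙 (B ≟ˢ B′)))
        ≡⟨ ∑-cong (allSubsets r) row-total ⟩
      ∑⟨ allSubsets r ⟩ (λ _ → 2 ^ r * N ^ r + N ^ suc r)
        ≡⟨ ∑-const (allSubsets r) _ ⟩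
      (2 ^ r * N ^ r + N ^ suc r) * length (allSubsets r)
        ≡⟨ cong ((2 ^ r * N ^ r + N ^ suc r) *_) (length-allSubsets r) ⟩
      (2 ^ r * N ^ r + N ^ suc r) * 2 ^ r ∎
      where
      open ≤-Reasoning
      row-total : ∀ B → ∑⟨ allSubsets r ⟩ (λ B′ → N ^ r + N ^ suc r * 𝟙 (B ≟ˢ B′)) ≡
                        2 ^ r * N ^ r + N ^ suc r
      row-total B = begin-equality
        ∑⟨ allSubsets r ⟩ (λ B′ → N ^ r + N ^ suc r * 𝟙 (B ≟ˢ B′))
          ≡⟨ ∑-distrib-+ (allSubsets r) _ _ ⟩
        ∑⟨ allSubsets r ⟩ (λ _ → N ^ r) + ∑⟨ allSubsets r ⟩ (λ B′ → N ^ suc r * 𝟙 (B ≟ˢ B′))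
          ≡⟨ cong₂ _+_ (∑-const (allSubsets r) (N ^ r))
                       (sym (*-distribˡ-∑ (N ^ suc r) (allSubsets r) _)) ⟩
        N ^ r * length (allSubsets r) + N ^ suc r * ∑⟨ allSubsets r ⟩ (λ B′ → 𝟙 (B ≟ˢ B′))
          ≡⟨ cong₂ _+_ (trans (cong (N ^ r *_) (length-allSubsets r)) (*-comm (N ^ r) (2 ^ r)))
                       (trans (cong (N ^ suc r *_) (∑-𝟙≡-allSubsets B)) (*-identityʳ (N ^ suc r))) ⟩
        2 ^ r * N ^ r + N ^ suc r ∎

badCount-bound : (N r : ℕ) .{{_ : NonZero N}} → 2 ^ r * badCount N r ≤ N * N ^ suc r
badCount-bound N r = *-cancelˡ-≤ c {{m^n≢0 2 r}} (+-cancelʳ-≤ (2 * c * N * (c * P)) _ _ (begin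
  c * (c * b) + 2 * c * N * (c * P)
    ≡⟨ cong₂ (λ b′ S → c * (c * b′) + 2 * c * N * S) (badCount≡∑ N r) (sym (∑-solutions N r)) ⟩
  c * (c * ∑⟨ outcomes N r ⟩ bad) + 2 * c * N * ∑⟨ outcomes N r ⟩ X
    ≡⟨ cong (_+ 2 * c * N * ∑⟨ outcomes N r ⟩ X) (*-assoc c c _) ⟨
  c * c * ∑⟨ outcomes N r ⟩ bad + 2 * c * N * ∑⟨ outcomes N r ⟩ X
    ≤⟨ second-moment-method (uncurry (noSubsetSum? N)) X (uncurry (noSubsetSum⇒solutions≡0 N r))
                            c N (outcomes N r) ⟩
  N * N * ∑⟨ outcomes N r ⟩ (λ p → X p * X p) + c * c * length (outcomes N r)
    ≤⟨ +-mono-≤ (≤-trans (≤-reflexive (*-assoc N N _)) (*-monoʳ-≤ N (∑-solutions² N r)))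
                (≤-reflexive (cong (c * c *_) (length-outcomes N r))) ⟩
  N * ((c * P + N * P) * c) + c * c * (P * N)
    ≡⟨ rearrange c N P ⟩
  c * (N * (N * P)) + 2 * c * N * (c * P) ∎))
  where
  open ≤-Reasoning
  c P b : ℕ
  c = 2 ^ r
  P = N ^ r
  b = badCount N r
  X bad : Vec (Fin N) r × Fin N → ℕ
  X = uncurry (solutions N r)
  bad = uncurry λ a t → 𝟙 (noSubsetSum? N a t)
  rearrange : ∀ c N P →
              N * ((c * P + N * P) * c) + c * c * (P * N) ≡ c * (N * (N * P)) + 2 * c * N * (c * P)
  rearrange = solve-∀

lemma4p1 : (N r k : ℕ) → .{{_ : NonZero N}} → 2 ≤ N → N ≡ 2 ^ k → r ≡ k + 4 →
    2 * badCount N r ≤ N ^ (r + 1)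
lemma4p1 N r k _ N≡2^k r≡k+4 = begin
  2 * badCount N r   ≤⟨ *-monoˡ-≤ (badCount N r) (m≤m+n 2 14) ⟩
  16 * badCount N r  ≤⟨ *-cancelˡ-≤ N (subst (_≤ N * N ^ suc r) 2^r*b≡N*[16*b] (badCount-bound N r)) ⟩
  N ^ suc r          ≡⟨ cong (N ^_) (+-comm 1 r) ⟩
  N ^ (r + 1)        ∎
  where
  open ≤-Reasoning
  2^r*b≡N*[16*b] : 2 ^ r * badCount N r ≡ N * (16 * badCount N r)
  2^r*b≡N*[16*b] = trans (cong (λ k → 2 ^ k * badCount N r) r≡k+4)
    (trans (cong (_* badCount N r) (trans (^-distribˡ-+-* 2 k 4) (cong (_* 16) (sym N≡2^k))))
           (*-assoc N 16 (badCount N r)))
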